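{- Let $c$ be a standard Coxeter element of $S_n$, let $1\le k<n$ be such that $s_k$ is initial in $c$, and let $c'=s_kcs_k$. Then for all $1<i<j<n$: the root $(i,j)$ is $c$-charmed if and only if either ($(i,j)$ is $c'$-charmed and $|\{i,j\}\cap\{k,k+1\}|$ is even) or ($(i,j)$ is $c'$-ordinary and $|\{i,j\}\cap\{k,k+1\}|$ is odd).
   Context: $S_n$ is the symmetric group, $s_i=(i,i+1)$; a standard Coxeter element is a product of $s_1,\dots,s_{n-1}$ each once in some order. A simple reflection $s$ is initial in $c$ if $\ell_S(sc)<\ell_S(c)$ ($\ell_S$ = Coxeter length = number of inversions); then $s c s$ is again a standard Coxeter element. Every standard Coxeter element $c$ is an $n$-cycle with cycle notation $(a_1,\dots,a_n)$ where $1=a_1<a_2<\dots<a_m=n>a_{m+1}>\dots>a_n$. Set $L_c=\{a_2,\dots,a_{m-1}\}$ and $R_c=\{a_{m+1},\dots,a_n\}$. For $1<i<j<n$, the root $(i,j)$ is $c$-charmed if ($i\in L_c$ and $j\in R_c$) or ($i\in R_c$ and $j\in L_c$), and $c$-ordinary otherwise. -}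

module Defs where

open import Data.Nat using (ℕ; zero; suc; _+_; _∸_; _<_; _≤_; _<ᵇ_; _≡ᵇ_)
open import Data.Bool using (Bool; true; false; if_then_else_)
open import Data.List using (List; []; _∷_; map; concatMap; applyUpTo; length; filterᵇ)
open import Data.List.Relation.Binary.Permutation.Propositional using (_↭_)
open import Data.Product using (_×_; _,_; proj₁; proj₂; Σ; ∃)
open import Data.Sum using (_⊎_)
open import Relation.Nullary using (¬_)
open import Relation.Binary.PropositionalEquality using (_≡_; _≢_)

-- Convention: elements of S_n are functions ℕ → ℕ acting on the labels 1..n
-- (all the permutations below fix every label outside 1..n).
-- Products compose as functions: (u v)(x) = u (v x).

Perm : Set
Perm = ℕ → ℕ

_∘ₚ_ : Perm → Perm → Perm
(u ∘ₚ v) x = u (v x)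

s : ℕ → Perm
s k x = if x ≡ᵇ k then suc k else (if x ≡ᵇ suc k then k else x)

wordProd : List ℕ → Perm
wordProd []       x = x
wordProd (k ∷ ks) x = s k (wordProd ks x)

oneTo : ℕ → List ℕ
oneTo m = applyUpTo suc m

IsStdCoxeter : ℕ → Perm → Set
IsStdCoxeter n c = Σ (List ℕ) λ ks → (ks ↭ oneTo (n ∸ 1)) × (∀ x → c x ≡ wordProd ks x)

pairs : ℕ → List (ℕ × ℕ)
pairs n = concatMap (λ b → map (λ a → a , b) (oneTo (b ∸ 1))) (oneTo n)

-- Coxeter length in S_n = number of inversions
len : ℕ → Perm → ℕ
len n w = length (filterᵇ (λ p → w (proj₂ p) <ᵇ w (proj₁ p)) (pairs n))

IsInitial : ℕ → ℕ → Perm → Set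
IsInitial n k c = len n (s k ∘ₚ c) < len n c

pow : Perm → ℕ → Perm
pow c zero    x = x
pow c (suc t) x = c (pow c t x)

-- Cycle notation (a_1, …, a_n) with a_1 = 1, a_{t+1} = c^t(1).
-- x occurs at position t+1 in the first period of the cycle through 1:
AtPos : Perm → ℕ → ℕ → Set
AtPos c x t = (pow c t 1 ≡ x) × (∀ r → 0 < r → r ≤ t → pow c r 1 ≢ 1)

-- L_c : labels strictly between 1 and n occurring before n in the cycle
InL : ℕ → Perm → ℕ → Set
InL n c x = (1 < x) × (x < n) × ∃ λ t → AtPos c x t × (∀ r → r ≤ t → pow c r 1 ≢ n)

-- R_c : labels strictly between 1 and n occurring after n in the cycle
InR : ℕ → Perm → ℕ → Set
InR n c x = (1 < x) × (x < n) × ∃ λ t → AtPos c x t × ∃ λ r → (r ≤ t) × (pow c r 1 ≡ n)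

Charmed : ℕ → Perm → ℕ → ℕ → Set
Charmed n c i j = (InL n c i × InR n c j) ⊎ (InR n c i × InL n c j)

Ordinary : ℕ → Perm → ℕ → ℕ → Set
Ordinary n c i j = ¬ Charmed n c i j

-- |{i, j} ∩ {k, k+1}|  (for i ≠ j)
inKK : ℕ → ℕ → ℕ
inKK k x = if x ≡ᵇ k then 1 else (if x ≡ᵇ suc k then 1 else 0)

interCount : ℕ → ℕ → ℕ → ℕ
interCount k i j = inKK k i + inKK k j

{-# OPTIONS --safe #-}
module Submission where

-- A standard Coxeter element c is unimodal: its cycle (1, a₂, …, n, …) rises from 1 to n
-- and falls back, so an interior label x lies in L_c iff c x > x and in R_c iff c x < x;
-- thus (i, j) is c-charmed iff exactly one of i, j is an ascent of c. Conjugation by s_k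
-- keeps the ascent status of every label other than k, k+1. Initiality, c⁻¹(k+1) < c⁻¹(k),
-- forces k and k+1 to have opposite statuses in c, and then conjugation swaps them and the
-- result is again unimodal. So charm changes exactly when |{i,j} ∩ {k,k+1}| is odd.

open import Defs
open import Algebra.Bundles using (CommutativeRing)
open import Data.Bool using (Bool; true; false; not; _∨_; _xor_; if_then_else_; T)
open import Data.Bool.Properties using (T-≡; ¬-not; xor-∧-commutativeRing)
open import Algebra.Properties.CommutativeSemigroup
  (CommutativeRing.+-commutativeSemigroup xor-∧-commutativeRing) using (interchange)
open import Data.Empty using (⊥; ⊥-elim)
open import Data.List using (List; []; _∷_; _++_; length; filterᵇ)
open import Data.List.Properties using (applyUpTo-∷ʳ; ++-identityʳ)
open import Data.List.Membership.Propositional using (_∈_)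
open import Data.List.Membership.Propositional.Properties
  using (∈-∃++; ∈-++⁻; ∈-++⁺ˡ; ∈-++⁺ʳ; ∈-applyUpTo⁻; ∈-applyUpTo⁺)
open import Data.List.Relation.Binary.Permutation.Propositional using (_↭_; ↭-sym; ↭⇒↭ₛ)
open import Data.List.Relation.Binary.Permutation.Propositional.Properties
  using (↭-singleton-inv; ∈-resp-↭; drop-mid)
import Data.List.Relation.Binary.Permutation.Setoid.Properties as Permutationₛ
open import Data.List.Relation.Unary.All as All using (All; []; _∷_)
open import Data.List.Relation.Unary.All.Properties using (concat⁺; map⁺; applyUpTo⁺₁)
open import Data.List.Relation.Unary.Any using (here; there)
open import Data.List.Relation.Unary.AllPairs using (_∷_)
open import Data.List.Relation.Unary.Unique.Propositional using (Unique)
import Data.List.Relation.Unary.Unique.Propositional.Properties as Unique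
open import Data.Nat using (ℕ; zero; suc; _+_; _∸_; _<_; _≤_; z≤n; s≤s; _≡ᵇ_; _<ᵇ_)
open import Data.Nat.DivMod using (_%_)
open import Data.Nat.Properties
open import Data.Product using (Σ; ∃; _×_; _,_; proj₁; proj₂)
open import Data.Product.Function.NonDependent.Propositional using (_×-⇔_)
open import Data.Sum using (_⊎_; inj₁; inj₂; [_,_]′; swap)
import Data.Sum as Sum
open import Data.Sum.Function.Propositional using (_⊎-⇔_)
open import Data.Unit using (tt)
open import Function using (_∘_; id)
open import Function.Bundles using (_⇔_; mk⇔; Equivalence)
open import Function.Construct.Composition using (_⇔-∘_)
open import Function.Construct.Symmetry using (⇔-sym)
open import Relation.Binary.PropositionalEquality
open import Relation.Nullary using (¬_; yes; no)

open Equivalence using (to; from)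

≡ᵇ-refl : ∀ k → (k ≡ᵇ k) ≡ true
≡ᵇ-refl zero    = refl
≡ᵇ-refl (suc k) = ≡ᵇ-refl k

≢⇒≡ᵇ-false : ∀ {x k} → x ≢ k → (x ≡ᵇ k) ≡ false
≢⇒≡ᵇ-false {x} {k} x≢k = ¬-not (x≢k ∘ ≡ᵇ⇒≡ x k ∘ from T-≡)

data Site (k x : ℕ) : Set where
  at-k      : x ≡ k → Site k x
  at-suc-k  : x ≡ suc k → Site k x
  elsewhere : x ≢ k → x ≢ suc k → Site k x

site : ∀ k x → Site k x
site k x with x ≟ k
... | yes x≡k = at-k x≡k
... | no x≢k with x ≟ suc k
...   | yes x≡k+1 = at-suc-k x≡k+1
...   | no x≢k+1  = elsewhere x≢k x≢k+1

s-at-k : ∀ k → s k k ≡ suc k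
s-at-k k rewrite ≡ᵇ-refl k = refl

s-at-suc-k : ∀ k → s k (suc k) ≡ k
s-at-suc-k k rewrite ≢⇒≡ᵇ-false (1+n≢n {k}) | ≡ᵇ-refl (suc k) = refl

s-elsewhere : ∀ k {x} → x ≢ k → x ≢ suc k → s k x ≡ x
s-elsewhere k x≢k x≢k+1 rewrite ≢⇒≡ᵇ-false x≢k | ≢⇒≡ᵇ-false x≢k+1 = refl

s-below : ∀ k {y} → y < k → s k y ≡ y
s-below k y<k = s-elsewhere k (<⇒≢ y<k) (<⇒≢ (m<n⇒m<1+n y<k))

s-above : ∀ k {y} → suc k < y → s k y ≡ y
s-above k k+1<y = s-elsewhere k (>⇒≢ (<-trans (n<1+n k) k+1<y)) (>⇒≢ k+1<y)

s-involutive : ∀ k x → s k (s k x) ≡ x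
s-involutive k x with site k x
... | at-k refl     rewrite s-at-k k     = s-at-suc-k k
... | at-suc-k refl rewrite s-at-suc-k k = s-at-k k
... | elsewhere x≢k x≢k+1 rewrite s-elsewhere k x≢k x≢k+1 = s-elsewhere k x≢k x≢k+1

s-bounded : ∀ k {N x} → 1 ≤ k → k < N → 1 ≤ x → x ≤ N → 1 ≤ s k x × s k x ≤ N
s-bounded k {x = x} 1≤k k<N 1≤x x≤N with site k x
... | at-k refl     rewrite s-at-k k     = s≤s z≤n , k<N
... | at-suc-k refl rewrite s-at-suc-k k = 1≤k , <⇒≤ k<N
... | elsewhere x≢k x≢k+1 rewrite s-elsewhere k x≢k x≢k+1 = 1≤x , x≤N

s-keeps-1< : ∀ k {y} → 1 < k → 1 < y → 1 < s k y
s-keeps-1< k {y} 1<k 1<y with site k y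
... | at-k refl     rewrite s-at-k k     = <-trans 1<k (n<1+n k)
... | at-suc-k refl rewrite s-at-suc-k k = 1<k
... | elsewhere y≢k y≢k+1 rewrite s-elsewhere k y≢k y≢k+1 = 1<y

s-same-side : ∀ k {x} y → x ≢ k → x ≢ suc k → (x < y → x < s k y) × (y < x → s k y < x)
s-same-side k y x≢k x≢k+1 with site k y
... | at-k refl rewrite s-at-k k =
  (λ x<k → <-trans x<k (n<1+n k)) , (λ k<x → ≤∧≢⇒< k<x (x≢k+1 ∘ sym))
... | at-suc-k refl rewrite s-at-suc-k k =
  (λ x<k+1 → ≤∧≢⇒< (≤-pred x<k+1) x≢k) , (λ k+1<x → <-trans (n<1+n k) k+1<x)
... | elsewhere y≢k y≢k+1 rewrite s-elsewhere k y≢k y≢k+1 = (λ x<y → x<y) , (λ y<x → y<x)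

s-preserves-< : ∀ k {y z} → z < y → ¬ (y ≡ suc k × z ≡ k) → s k z < s k y
s-preserves-< k {y} {z} z<y not-kk+1 with site k y | site k z
... | at-k refl | at-k refl = ⊥-elim (<-irrefl refl z<y)
... | at-k refl | at-suc-k refl = ⊥-elim (<-asym z<y (n<1+n k))
... | at-k refl | elsewhere z≢k z≢k+1 rewrite s-at-k k | s-elsewhere k z≢k z≢k+1 =
  <-trans z<y (n<1+n k)
... | at-suc-k refl | at-k refl = ⊥-elim (not-kk+1 (refl , refl))
... | at-suc-k refl | at-suc-k refl = ⊥-elim (<-irrefl refl z<y)
... | at-suc-k refl | elsewhere z≢k z≢k+1 rewrite s-at-suc-k k | s-elsewhere k z≢k z≢k+1 =
  ≤∧≢⇒< (≤-pred z<y) z≢k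
... | elsewhere y≢k y≢k+1 | at-k refl rewrite s-at-k k | s-elsewhere k y≢k y≢k+1 =
  ≤∧≢⇒< z<y (y≢k+1 ∘ sym)
... | elsewhere y≢k y≢k+1 | at-suc-k refl rewrite s-at-suc-k k | s-elsewhere k y≢k y≢k+1 =
  <-trans (n<1+n k) z<y
... | elsewhere y≢k y≢k+1 | elsewhere z≢k z≢k+1
  rewrite s-elsewhere k y≢k y≢k+1 | s-elsewhere k z≢k z≢k+1 = z<y

s-comm-distant : ∀ j K x → suc j < K → s K (s j x) ≡ s j (s K x)
s-comm-distant j K x j+1<K with site j x
... | at-k refl
  rewrite s-at-k j | s-below K (<-trans (n<1+n j) j+1<K) | s-at-k j = s-below K j+1<K
... | at-suc-k refl
  rewrite s-at-suc-k j | s-below K (<-trans (n<1+n j) j+1<K) | s-below K j+1<K =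
  sym (s-at-suc-k j)
... | elsewhere x≢j x≢j+1 rewrite s-elsewhere j x≢j x≢j+1 with site K x
...   | at-k refl rewrite s-at-k K = sym (s-above j (<-trans j+1<K (n<1+n K)))
...   | at-suc-k refl rewrite s-at-suc-k K = sym (s-above j j+1<K)
...   | elsewhere x≢K x≢K+1 rewrite s-elsewhere K x≢K x≢K+1 = sym (s-elsewhere j x≢j x≢j+1)

moves : ℕ → ℕ → Bool
moves k x = (x ≡ᵇ k) ∨ (x ≡ᵇ suc k)

moves-at-k : ∀ k → moves k k ≡ true
moves-at-k k rewrite ≡ᵇ-refl k = refl

moves-at-suc-k : ∀ k → moves k (suc k) ≡ true
moves-at-suc-k k rewrite ≢⇒≡ᵇ-false (1+n≢n {k}) | ≡ᵇ-refl (suc k) = refl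

moves-elsewhere : ∀ k {x} → x ≢ k → x ≢ suc k → moves k x ≡ false
moves-elsewhere k x≢k x≢k+1 rewrite ≢⇒≡ᵇ-false x≢k | ≢⇒≡ᵇ-false x≢k+1 = refl

Up : Perm → Perm → ℕ → Set
Up c d x = x < c x × d x < x

Down : Perm → Perm → ℕ → Set
Down c d x = Up d c x

-- The cycle of c (whose inverse is d) rises from 1 to n and falls back to 1.
record Unimodal (n : ℕ) (c d : Perm) : Set where
  field
    inverseʳ      : ∀ x → c (d x) ≡ x
    inverseˡ      : ∀ x → d (c x) ≡ x
    c-bounded     : ∀ x → 1 ≤ x → x ≤ n → 1 ≤ c x × c x ≤ n
    d-bounded     : ∀ x → 1 ≤ x → x ≤ n → 1 ≤ d x × d x ≤ n
    c-fixes-above : ∀ x → n < x → c x ≡ x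
    d-fixes-above : ∀ x → n < x → d x ≡ x
    c-1           : 1 < c 1
    d-1           : 1 < d 1
    c-n           : c n < n
    d-n           : d n < n
    up-or-down    : ∀ x → 1 < x → x < n → Up c d x ⊎ Down c d x

Unimodal-sym : ∀ {n c d} → Unimodal n c d → Unimodal n d c
Unimodal-sym u = record
  { inverseʳ = inverseˡ ; inverseˡ = inverseʳ
  ; c-bounded = d-bounded ; d-bounded = c-bounded
  ; c-fixes-above = d-fixes-above ; d-fixes-above = c-fixes-above
  ; c-1 = d-1 ; d-1 = c-1 ; c-n = d-n ; d-n = c-n
  ; up-or-down = λ x 1<x x<n → swap (up-or-down x 1<x x<n) }
  where open Unimodal u

Unimodal-cong : ∀ {n c c′ d} → (∀ x → c x ≡ c′ x) → Unimodal n c d → Unimodal n c′ d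
Unimodal-cong {n} {c} {c′} {d} c≗c′ u = record
  { inverseʳ = λ x → trans (sym (c≗c′ (d x))) (inverseʳ x)
  ; inverseˡ = λ x → trans (cong d (sym (c≗c′ x))) (inverseˡ x)
  ; c-bounded = λ x 1≤x x≤n → subst (λ y → 1 ≤ y × y ≤ n) (c≗c′ x) (c-bounded x 1≤x x≤n)
  ; d-bounded = d-bounded
  ; c-fixes-above = λ x n<x → trans (sym (c≗c′ x)) (c-fixes-above x n<x)
  ; d-fixes-above = d-fixes-above
  ; c-1 = subst (1 <_) (c≗c′ 1) c-1
  ; d-1 = d-1
  ; c-n = subst (_< n) (c≗c′ n) c-n
  ; d-n = d-n
  ; up-or-down = λ x 1<x x<n →
      subst (λ y → (x < y × d x < x) ⊎ (x < d x × y < x)) (c≗c′ x) (up-or-down x 1<x x<n) }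
  where open Unimodal u

Unimodal-s₁ : Unimodal 2 (s 1) (s 1)
Unimodal-s₁ = record
  { inverseʳ = s-involutive 1 ; inverseˡ = s-involutive 1
  ; c-bounded = λ x → s-bounded 1 ≤-refl ≤-refl
  ; d-bounded = λ x → s-bounded 1 ≤-refl ≤-refl
  ; c-fixes-above = λ x → s-above 1 ; d-fixes-above = λ x → s-above 1
  ; c-1 = s≤s (s≤s z≤n) ; d-1 = s≤s (s≤s z≤n)
  ; c-n = s≤s (s≤s z≤n) ; d-n = s≤s (s≤s z≤n)
  ; up-or-down = λ x 1<x x<2 → ⊥-elim (<⇒≱ 1<x (≤-pred x<2)) }

extend-bounded : ∀ {n} (f : Perm) → (∀ x → 1 ≤ x → x ≤ n → 1 ≤ f x × f x ≤ n) →
                 (∀ x → n < x → f x ≡ x) → ∀ x → 1 ≤ x → x ≤ suc n → 1 ≤ f x × f x ≤ suc n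
extend-bounded {n} f f-bounded f-fixes x 1≤x x≤n+1 with m≤n⇒m<n∨m≡n x≤n+1
... | inj₁ x<n+1 = proj₁ (f-bounded x 1≤x (≤-pred x<n+1)) , m≤n⇒m≤1+n (proj₂ (f-bounded x 1≤x (≤-pred x<n+1)))
... | inj₂ refl = subst (λ y → 1 ≤ y × y ≤ suc n) (sym (f-fixes (suc n) (n<1+n n))) (1≤x , x≤n+1)

extendʳ : ∀ {n c d} → 1 < n → Unimodal n c d → Unimodal (suc n) (c ∘ₚ s n) (s n ∘ₚ d)
extendʳ {n} {c} {d} 1<n u = record
  { inverseʳ = λ x → trans (cong c (s-involutive n (d x))) (inverseʳ x)
  ; inverseˡ = λ x → trans (cong (s n) (inverseˡ (s n x))) (s-involutive n x)
  ; c-bounded = λ x 1≤x x≤n+1 →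
      let (1≤sx , sx≤n+1) = s-bounded n 1≤n (n<1+n n) 1≤x x≤n+1
      in extend-bounded c c-bounded c-fixes-above (s n x) 1≤sx sx≤n+1
  ; d-bounded = λ x 1≤x x≤n+1 →
      let (1≤dx , dx≤n+1) = extend-bounded d d-bounded d-fixes-above x 1≤x x≤n+1
      in s-bounded n 1≤n (n<1+n n) 1≤dx dx≤n+1
  ; c-fixes-above = λ x n+1<x → trans (cong c (s-above n n+1<x)) (c-fixes-above x (<-trans (n<1+n n) n+1<x))
  ; d-fixes-above = λ x n+1<x → trans (cong (s n) (d-fixes-above x (<-trans (n<1+n n) n+1<x))) (s-above n n+1<x)
  ; c-1 = subst (λ y → 1 < c y) (sym (s-below n 1<n)) c-1
  ; d-1 = s-keeps-1< n 1<n d-1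
  ; c-n = subst (λ y → c y < suc n) (sym (s-at-suc-k n)) (<-trans c-n (n<1+n n))
  ; d-n = subst (λ y → s n y < suc n) (sym (d-fixes-above (suc n) (n<1+n n)))
                (subst (_< suc n) (sym (s-at-suc-k n)) (n<1+n n))
  ; up-or-down = up-or-down′ }
  where
  open Unimodal u
  1≤n : 1 ≤ n
  1≤n = <⇒≤ 1<n
  up-or-down′ : ∀ x → 1 < x → x < suc n → Up (c ∘ₚ s n) (s n ∘ₚ d) x ⊎ Down (c ∘ₚ s n) (s n ∘ₚ d) x
  up-or-down′ x 1<x x<n+1 with m≤n⇒m<n∨m≡n (≤-pred x<n+1)
  ... | inj₂ refl rewrite s-at-k x =
    inj₁ (subst (x <_) (sym (c-fixes-above (suc x) (n<1+n x))) (n<1+n x) , subst (_< x) (sym (s-below x d-n)) d-n)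
  ... | inj₁ x<n rewrite s-below n x<n with up-or-down x 1<x x<n
  ...   | inj₁ (x<cx , dx<x) = inj₁ (x<cx , proj₂ (s-same-side n (d x) (<⇒≢ x<n) (<⇒≢ (m<n⇒m<1+n x<n))) dx<x)
  ...   | inj₂ (x<dx , cx<x) = inj₂ (proj₁ (s-same-side n (d x) (<⇒≢ x<n) (<⇒≢ (m<n⇒m<1+n x<n))) x<dx , cx<x)

extendˡ : ∀ {n c d} → 1 < n → Unimodal n c d → Unimodal (suc n) (s n ∘ₚ c) (d ∘ₚ s n)
extendˡ 1<n u = Unimodal-sym (extendʳ 1<n (Unimodal-sym u))

wordProd-++ : ∀ xs ys x → wordProd (xs ++ ys) x ≡ wordProd xs (wordProd ys x)
wordProd-++ []       ys x = refl
wordProd-++ (k ∷ xs) ys x = cong (s k) (wordProd-++ xs ys x)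

wordProd-comm-s : ∀ K xs x → All (λ j → suc j < K) xs → wordProd xs (s K x) ≡ s K (wordProd xs x)
wordProd-comm-s K []       x []           = refl
wordProd-comm-s K (j ∷ xs) x (j+1<K ∷ js) =
  trans (cong (s j) (wordProd-comm-s K xs x js)) (sym (s-comm-distant j K (wordProd xs x) j+1<K))

Unique-++-disjoint : ∀ (xs : List ℕ) {ys x} → Unique (xs ++ ys) → x ∈ xs → x ∈ ys → ⊥
Unique-++-disjoint (a ∷ xs) (a∉ ∷ _) (here refl) x∈ys = All.lookup a∉ (∈-++⁺ʳ xs x∈ys) refl
Unique-++-disjoint (a ∷ xs) (_ ∷ u) (there x∈xs) x∈ys = Unique-++-disjoint xs u x∈xs x∈ys

Unique-oneTo : ∀ m → Unique (oneTo m)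
Unique-oneTo m = Unique.applyUpTo⁺₁ suc m (λ i<j _ e → <⇒≢ i<j (suc-injective e))

-- s_N commutes with every s_j, j < N - 1, so it moves to whichever end of the word is
-- not separated from it by s_{N-1}; the remaining word is unimodal on 1..N by induction.
wordProd-unimodal : ∀ m ks → ks ↭ oneTo (suc m) → Σ Perm (Unimodal (suc (suc m)) (wordProd ks))
wordProd-unimodal zero ks ks↭[1] rewrite ↭-singleton-inv ks↭[1] = s 1 , Unimodal-s₁
wordProd-unimodal (suc m) ks ks↭ with ∈-∃++ (∈-resp-↭ (↭-sym ks↭′) (∈-++⁺ʳ (oneTo (suc m)) (here refl)))
  where
  ks↭′ : ks ↭ oneTo (suc m) ++ (suc (suc m) ∷ [])
  ks↭′ = subst (ks ↭_) (sym (applyUpTo-∷ʳ suc (suc m))) ks↭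
... | xs , ys , refl = result
  where
  N = suc (suc m)
  rest↭ : xs ++ ys ↭ oneTo (suc m)
  rest↭ = subst (xs ++ ys ↭_) (++-identityʳ _)
            (drop-mid xs (oneTo (suc m)) (subst (xs ++ N ∷ ys ↭_) (sym (applyUpTo-∷ʳ suc (suc m))) ks↭))
  rest = wordProd-unimodal m (xs ++ ys) rest↭
  unique : Unique (xs ++ ys)
  unique = Permutationₛ.Unique-resp-↭ (setoid ℕ) (↭⇒↭ₛ (↭-sym rest↭)) (Unique-oneTo (suc m))
  N-1∈ : suc m ∈ xs ++ ys
  N-1∈ = ∈-resp-↭ (↭-sym rest↭) (∈-applyUpTo⁺ suc (n<1+n m))
  distant : ∀ {j} → j ∈ xs ++ ys → j ≢ suc m → suc j < N
  distant j∈ j≢m+1 with ∈-applyUpTo⁻ suc (∈-resp-↭ rest↭ j∈)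
  ... | i , i<m+1 , refl = s≤s (≤∧≢⇒< i<m+1 j≢m+1)
  result : Σ Perm (Unimodal (suc N) (wordProd (xs ++ N ∷ ys)))
  result with ∈-++⁻ xs N-1∈
  ... | inj₂ N-1∈ys = d ∘ₚ s N , Unimodal-cong word≗ (extendˡ (s≤s (s≤s z≤n)) (proj₂ rest))
    where
    d = proj₁ rest
    xs-distant : All (λ j → suc j < N) xs
    xs-distant = All.tabulate λ j∈xs →
      distant (∈-++⁺ˡ j∈xs) (λ { refl → Unique-++-disjoint xs unique j∈xs N-1∈ys })
    word≗ : ∀ x → s N (wordProd (xs ++ ys) x) ≡ wordProd (xs ++ N ∷ ys) x
    word≗ x = begin
      s N (wordProd (xs ++ ys) x)       ≡⟨ cong (s N) (wordProd-++ xs ys x) ⟩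
      s N (wordProd xs (wordProd ys x)) ≡⟨ wordProd-comm-s N xs _ xs-distant ⟨
      wordProd xs (s N (wordProd ys x)) ≡⟨ wordProd-++ xs (N ∷ ys) x ⟨
      wordProd (xs ++ N ∷ ys) x         ∎
      where open ≡-Reasoning
  ... | inj₁ N-1∈xs = s N ∘ₚ d , Unimodal-cong word≗ (extendʳ (s≤s (s≤s z≤n)) (proj₂ rest))
    where
    d = proj₁ rest
    ys-distant : All (λ j → suc j < N) ys
    ys-distant = All.tabulate λ j∈ys →
      distant (∈-++⁺ʳ xs j∈ys) (λ { refl → Unique-++-disjoint xs unique N-1∈xs j∈ys })
    word≗ : ∀ x → wordProd (xs ++ ys) (s N x) ≡ wordProd (xs ++ N ∷ ys) x
    word≗ x = begin
      wordProd (xs ++ ys) (s N x)       ≡⟨ wordProd-++ xs ys (s N x) ⟩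
      wordProd xs (wordProd ys (s N x)) ≡⟨ cong (wordProd xs) (wordProd-comm-s N ys x ys-distant) ⟩
      wordProd xs (s N (wordProd ys x)) ≡⟨ wordProd-++ xs (N ∷ ys) x ⟨
      wordProd (xs ++ N ∷ ys) x         ∎
      where open ≡-Reasoning

stdCoxeter-unimodal : ∀ {n c} → 1 < n → IsStdCoxeter n c → Σ Perm (Unimodal n c)
stdCoxeter-unimodal {suc (suc m)} (s≤s (s≤s z≤n)) (ks , ks↭ , c≗) =
  let (d , u) = wordProd-unimodal m ks ks↭ in d , Unimodal-cong (sym ∘ c≗) u

≤1+⇒≤⊎≡ : ∀ {r t} → r ≤ suc t → r ≤ t ⊎ r ≡ suc t
≤1+⇒≤⊎≡ r≤t+1 with m≤n⇒m<n∨m≡n r≤t+1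
... | inj₁ r<t+1 = inj₁ (≤-pred r<t+1)
... | inj₂ r≡t+1 = inj₂ r≡t+1

1≤⇒≡1⊎1< : ∀ {x} → 1 ≤ x → x ≡ 1 ⊎ 1 < x
1≤⇒≡1⊎1< 1≤x with m≤n⇒m<n∨m≡n 1≤x
... | inj₁ 1<x = inj₂ 1<x
... | inj₂ 1≡x = inj₁ (sym 1≡x)

ascends : Perm → ℕ → Bool
ascends c x = x <ᵇ c x

T-xor : ∀ {a b} → T (a xor b) ⇔ ((T a × ¬ T b) ⊎ (¬ T a × T b))
T-xor {true}  {true}  = mk⇔ (λ ()) [ (λ (_ , ¬b) → ¬b tt) , (λ (¬a , _) → ¬a tt) ]′
T-xor {true}  {false} = mk⇔ (λ _ → inj₁ (tt , λ ())) (λ _ → tt)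
T-xor {false} {true}  = mk⇔ (λ _ → inj₂ ((λ ()) , tt)) (λ _ → tt)
T-xor {false} {false} = mk⇔ (λ ()) [ (λ ()) ∘ proj₁ , (λ ()) ∘ proj₂ ]′

module CycleOrder {n : ℕ} {c d : Perm} (u : Unimodal n c d) where
  open Unimodal u

  orbit : ℕ → ℕ
  orbit t = pow c t 1

  1≤n : 1 ≤ n
  1≤n = ≤-<-trans z≤n c-n

  1<n : 1 < n
  1<n = ≤-<-trans (proj₁ (c-bounded n 1≤n ≤-refl)) c-n

  orbit-bounded : ∀ t → 1 ≤ orbit t × orbit t ≤ n
  orbit-bounded zero    = ≤-refl , 1≤n
  orbit-bounded (suc t) = c-bounded (orbit t) (proj₁ (orbit-bounded t)) (proj₂ (orbit-bounded t))

  no-fixed-point : ∀ x → 1 ≤ x → x ≤ n → c x ≢ x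
  no-fixed-point x 1≤x x≤n cx≡x with 1≤⇒≡1⊎1< 1≤x
  ... | inj₁ refl = <-irrefl (sym cx≡x) c-1
  ... | inj₂ 1<x with m≤n⇒m<n∨m≡n x≤n
  ...   | inj₂ refl = <-irrefl cx≡x c-n
  ...   | inj₁ x<n with up-or-down x 1<x x<n
  ...     | inj₁ (x<cx , _) = <-irrefl (sym cx≡x) x<cx
  ...     | inj₂ (_ , cx<x) = <-irrefl cx≡x cx<x

  Climb : ℕ → Set
  Climb y = ∃ λ t → AtPos c y t × (∀ r → r ≤ t → orbit r ≤ y)

  -- Going backwards along d from an ascent strictly decreases the label until it reaches 1
  climb : ∀ b y → y ≤ b → y ≤ n → y ≡ 1 ⊎ (1 < y × d y < y) → Climb y
  climb b y _ _ (inj₁ refl) =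
    0 , (refl , λ { zero () ; (suc r) _ () }) , λ { zero _ → ≤-refl ; (suc r) () }
  climb zero y y≤0 _ (inj₂ (1<y , _)) = ⊥-elim (<⇒≱ 1<y (≤-trans y≤0 z≤n))
  climb (suc b) y y≤b+1 y≤n (inj₂ (1<y , dy<y)) =
    suc t , (reaches , no-return) , bounded
    where
    z = d y
    z-bounded = d-bounded y (<⇒≤ 1<y) y≤n
    z-climbs : z ≡ 1 ⊎ (1 < z × d z < z)
    z-climbs with 1≤⇒≡1⊎1< (proj₁ z-bounded)
    ... | inj₁ z≡1 = inj₁ z≡1
    ... | inj₂ 1<z with up-or-down z 1<z (<-≤-trans dy<y y≤n)
    ...   | inj₁ (_ , dz<z) = inj₂ (1<z , dz<z)
    ...   | inj₂ (_ , cz<z) = ⊥-elim (<-asym dy<y (subst (_< z) (inverseʳ y) cz<z))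
    previous = climb b z (≤-pred (≤-trans dy<y y≤b+1)) (proj₂ z-bounded) z-climbs
    t = proj₁ previous
    reaches : orbit (suc t) ≡ y
    reaches = trans (cong c (proj₁ (proj₁ (proj₂ previous)))) (inverseʳ y)
    no-return : ∀ r → 0 < r → r ≤ suc t → orbit r ≢ 1
    no-return r 0<r r≤t+1 with ≤1+⇒≤⊎≡ r≤t+1
    ... | inj₁ r≤t = proj₂ (proj₁ (proj₂ previous)) r 0<r r≤t
    ... | inj₂ refl = λ e → <-irrefl (sym (trans (sym reaches) e)) 1<y
    bounded : ∀ r → r ≤ suc t → orbit r ≤ y
    bounded r r≤t+1 with ≤1+⇒≤⊎≡ r≤t+1
    ... | inj₁ r≤t = ≤-trans (proj₂ (proj₂ previous) r r≤t) (<⇒≤ dy<y)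
    ... | inj₂ refl = ≤-reflexive reaches

  climb-ascent : ∀ x → 1 ≤ x → x < n → x < c x → Climb x
  climb-ascent x 1≤x x<n x<cx = climb x x ≤-refl (<⇒≤ x<n) x-climbs
    where
    x-climbs : x ≡ 1 ⊎ (1 < x × d x < x)
    x-climbs with 1≤⇒≡1⊎1< 1≤x
    ... | inj₁ x≡1 = inj₁ x≡1
    ... | inj₂ 1<x with up-or-down x 1<x x<n
    ...   | inj₁ (_ , dx<x) = inj₂ (1<x , dx<x)
    ...   | inj₂ (_ , cx<x) = ⊥-elim (<-asym x<cx cx<x)

  climb-n : Climb n
  climb-n = climb n n ≤-refl ≤-refl (inj₂ (1<n , d-n))

  Fall : ℕ → Set
  Fall y = ∃ λ t → AtPos c y t × ∃ λ r → r ≤ t × orbit r ≡ n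

  -- Going backwards along d from a descent strictly increases the label until it reaches n
  fall : ∀ b y → n ∸ y ≤ b → 1 < y → y ≤ n → y ≡ n ⊎ (y < n × y < d y) → Fall y
  fall b y _ _ _ (inj₁ refl) =
    let (t , at , _) = climb-n in t , at , t , ≤-refl , proj₁ at
  fall zero y n-y≤0 _ _ (inj₂ (y<n , _)) = ⊥-elim (<⇒≱ (m<n⇒0<n∸m y<n) n-y≤0)
  fall (suc b) y n-y≤b+1 1<y y≤n (inj₂ (y<n , y<dy)) =
    suc t , (reaches , no-return) , r , m≤n⇒m≤1+n r≤t , orbit-r≡n
    where
    z = d y
    z-bounded = d-bounded y (<⇒≤ 1<y) y≤n
    z-falls : z ≡ n ⊎ (z < n × z < d z)
    z-falls with m≤n⇒m<n∨m≡n (proj₂ z-bounded)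
    ... | inj₂ z≡n = inj₁ z≡n
    ... | inj₁ z<n with up-or-down z (<-trans 1<y y<dy) z<n
    ...   | inj₂ (z<dz , _) = inj₂ (z<n , z<dz)
    ...   | inj₁ (z<cz , _) = ⊥-elim (<-asym y<dy (subst (z <_) (inverseʳ y) z<cz))
    previous = fall b z (≤-pred (≤-trans (∸-monoʳ-< y<dy (proj₂ z-bounded)) n-y≤b+1))
                 (<-trans 1<y y<dy) (proj₂ z-bounded) z-falls
    t = proj₁ previous
    r = proj₁ (proj₂ (proj₂ previous))
    r≤t = proj₁ (proj₂ (proj₂ (proj₂ previous)))
    orbit-r≡n = proj₂ (proj₂ (proj₂ (proj₂ previous)))
    reaches : orbit (suc t) ≡ y
    reaches = trans (cong c (proj₁ (proj₁ (proj₂ previous)))) (inverseʳ y)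
    no-return : ∀ r → 0 < r → r ≤ suc t → orbit r ≢ 1
    no-return r 0<r r≤t+1 with ≤1+⇒≤⊎≡ r≤t+1
    ... | inj₁ r≤t = proj₂ (proj₁ (proj₂ previous)) r 0<r r≤t
    ... | inj₂ refl = λ e → <-irrefl (sym (trans (sym reaches) e)) 1<y

  ascending-before-n : ∀ t → (∀ r → r ≤ t → orbit r ≢ n) →
                       orbit t ≡ 1 ⊎ (1 < orbit t × orbit t < c (orbit t))
  ascending-before-n zero    _        = inj₁ refl
  ascending-before-n (suc t) before-n = step (up-or-down y′ 1<y′ y′<n)
    where
    y = orbit t
    y<cy : y < c y
    y<cy with ascending-before-n t (λ r r≤t → before-n r (m≤n⇒m≤1+n r≤t))
    ... | inj₁ y≡1 = subst (λ w → w < c w) (sym y≡1) c-1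
    ... | inj₂ (_ , y<cy) = y<cy
    y′ = c y
    1<y′ = ≤-<-trans (proj₁ (orbit-bounded t)) y<cy
    y′<n = ≤∧≢⇒< (proj₂ (orbit-bounded (suc t))) (before-n (suc t) ≤-refl)
    step : Up c d y′ ⊎ Down c d y′ → y′ ≡ 1 ⊎ (1 < y′ × y′ < c y′)
    step (inj₁ (y′<cy′ , _)) = inj₂ (1<y′ , y′<cy′)
    step (inj₂ (y′<dy′ , _)) = ⊥-elim (<-asym y<cy (subst (y′ <_) (inverseˡ y) y′<dy′))

  descending-after-n : ∀ {t r} → orbit r ≡ n → (∀ q → 0 < q → q ≤ t → orbit q ≢ 1) →
                       ∀ j → r + j ≤ t → orbit (r + j) ≡ n ⊎ c (orbit (r + j)) < orbit (r + j)
  descending-after-n {r = r} orbit-r≡n _ zero _ rewrite +-identityʳ r = inj₁ orbit-r≡n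
  descending-after-n {t} {r} orbit-r≡n no-return (suc j) r+j+1≤t rewrite +-suc r j =
    step (up-or-down y′ 1<y′ y′<n)
    where
    y = orbit (r + j)
    cy<y : c y < y
    cy<y with descending-after-n orbit-r≡n no-return j (≤-trans (n≤1+n _) r+j+1≤t)
    ... | inj₁ y≡n = subst (λ w → c w < w) (sym y≡n) c-n
    ... | inj₂ cy<y = cy<y
    y′ = c y
    1<y′ : 1 < y′
    1<y′ = ≤∧≢⇒< (proj₁ (orbit-bounded (suc (r + j))))
                 (no-return (suc (r + j)) (s≤s z≤n) r+j+1≤t ∘ sym)
    y′<n = <-≤-trans cy<y (proj₂ (orbit-bounded (r + j)))
    step : Up c d y′ ⊎ Down c d y′ → y′ ≡ n ⊎ c y′ < y′
    step (inj₂ (_ , cy′<y′)) = inj₂ cy′<y′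
    step (inj₁ (_ , dy′<y′)) = ⊥-elim (<-asym cy<y (subst (_< y′) (inverseˡ y) dy′<y′))

  InL⇒ascent : ∀ {x} → InL n c x → x < c x
  InL⇒ascent (1<x , _ , t , (orbit-t≡x , _) , before-n) with ascending-before-n t before-n
  ... | inj₁ orbit-t≡1 = ⊥-elim (<-irrefl (trans (sym orbit-t≡1) orbit-t≡x) 1<x)
  ... | inj₂ (_ , ascent) = subst (λ w → w < c w) orbit-t≡x ascent

  ascent⇒InL : ∀ {x} → 1 < x → x < n → x < c x → InL n c x
  ascent⇒InL {x} 1<x x<n x<cx =
    let (t , at , below-x) = climb-ascent x (<⇒≤ 1<x) x<n x<cx
    in 1<x , x<n , t , at , λ r r≤t orbit-r≡n → <-irrefl orbit-r≡n (≤-<-trans (below-x r r≤t) x<n)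

  InR⇒descent : ∀ {x} → InR n c x → c x < x
  InR⇒descent {x} (_ , x<n , t , (orbit-t≡x , no-return) , r , r≤t , orbit-r≡n) =
    [ (λ ≡n → ⊥-elim (<-irrefl (trans (sym x≡) ≡n) x<n)) , subst (λ w → c w < w) x≡ ]′
      (descending-after-n orbit-r≡n no-return (t ∸ r) (≤-reflexive (m+[n∸m]≡n r≤t)))
    where
    x≡ : orbit (r + (t ∸ r)) ≡ x
    x≡ = trans (cong orbit (m+[n∸m]≡n r≤t)) orbit-t≡x

  descent⇒InR : ∀ {x} → 1 < x → x < n → c x < x → InR n c x
  descent⇒InR {x} 1<x x<n cx<x = 1<x , x<n , fall (n ∸ x) x ≤-refl 1<x (<⇒≤ x<n) (inj₂ (x<n , x<dx))
    where
    x<dx : x < d x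
    x<dx with up-or-down x 1<x x<n
    ... | inj₁ (x<cx , _) = ⊥-elim (<-asym cx<x x<cx)
    ... | inj₂ (x<dx , _) = x<dx

  InL⇔ascends : ∀ {x} → 1 < x → x < n → InL n c x ⇔ T (ascends c x)
  InL⇔ascends 1<x x<n = mk⇔ (<⇒<ᵇ ∘ InL⇒ascent) (ascent⇒InL 1<x x<n ∘ <ᵇ⇒< _ _)

  InR⇔¬ascends : ∀ {x} → 1 < x → x < n → InR n c x ⇔ (¬ T (ascends c x))
  InR⇔¬ascends {x} 1<x x<n = mk⇔
    (λ inR ascent → <-asym (InR⇒descent inR) (<ᵇ⇒< _ _ ascent))
    (λ ¬ascent → descent⇒InR 1<x x<n
      (≤∧≢⇒< (≮⇒≥ (¬ascent ∘ <⇒<ᵇ)) (no-fixed-point x (<⇒≤ 1<x) (<⇒≤ x<n))))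

  Charmed⇔ascents-differ : ∀ {i j} → 1 < i → i < n → 1 < j → j < n →
                           Charmed n c i j ⇔ T (ascends c i xor ascends c j)
  Charmed⇔ascents-differ 1<i i<n 1<j j<n = ⇔-sym T-xor ⇔-∘
    ((InL⇔ascends 1<i i<n ×-⇔ InR⇔¬ascends 1<j j<n) ⊎-⇔ (InR⇔¬ascends 1<i i<n ×-⇔ InL⇔ascends 1<j j<n))

  ascent-image-≤ : ∀ {x y} → 1 ≤ x → x < n → x < c x → 1 < y → y < n → y < c y → x < y → c x ≤ y
  ascent-image-≤ {x} {y} 1≤x x<n x<cx 1<y y<n y<cy x<y
    with climb-ascent x 1≤x x<n x<cx | climb-ascent y (<⇒≤ 1<y) y<n y<cy
  ... | tx , (orbit-tx≡x , _) , below-x | ty , (orbit-ty≡y , _) , below-y with tx <? ty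
  ...   | yes tx<ty = subst (_≤ y) (cong c orbit-tx≡x) (below-y (suc tx) tx<ty)
  ...   | no tx≮ty  = ⊥-elim (<⇒≱ x<y (subst (_≤ x) orbit-ty≡y (below-x ty (≮⇒≥ tx≮ty))))

up-down-exclusive : ∀ {c d x} → Up c d x → Down c d x → ⊥
up-down-exclusive (x<cx , _) (_ , cx<x) = <-asym x<cx cx<x

ascends-up : ∀ c d {x} → Up c d x → ascends c x ≡ true
ascends-up _ _ (x<cx , _) = to T-≡ (<⇒<ᵇ x<cx)

ascends-down : ∀ c d {x} → Down c d x → ascends c x ≡ false
ascends-down _ _ (_ , cx<x) = ¬-not (λ e → <-asym cx<x (<ᵇ⇒< _ _ (from T-≡ e)))

ascends-flipped : ∀ c d c′ d′ {x} → (Up c d x → Down c′ d′ x) × (Down c d x → Up c′ d′ x) →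
                  Up c d x ⊎ Down c d x → ascends c′ x ≡ not (ascends c x)
ascends-flipped c d c′ d′ (to-down , _) (inj₁ up) =
  trans (ascends-down c′ d′ (to-down up)) (cong not (sym (ascends-up c d up)))
ascends-flipped c d c′ d′ (_ , to-up) (inj₂ down) =
  trans (ascends-up c′ d′ (to-up down)) (cong not (sym (ascends-down c d down)))

ascends-kept : ∀ c d c′ d′ {x} → (Up c d x → Up c′ d′ x) × (Down c d x → Down c′ d′ x) →
               Up c d x ⊎ Down c d x → ascends c′ x ≡ ascends c x
ascends-kept c d c′ d′ (keep-up , _) (inj₁ up) =
  trans (ascends-up c′ d′ (keep-up up)) (sym (ascends-up c d up))
ascends-kept c d c′ d′ (_ , keep-down) (inj₂ down) =
  trans (ascends-down c′ d′ (keep-down down)) (sym (ascends-down c d down))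

conj : ℕ → Perm → Perm
conj k f = s k ∘ₚ (f ∘ₚ s k)

conj-inverse : ∀ k f g → (∀ x → f (g x) ≡ x) → ∀ x → conj k f (conj k g x) ≡ x
conj-inverse k f g fg x = begin
  s k (f (s k (s k (g (s k x))))) ≡⟨ cong (s k ∘ f) (s-involutive k (g (s k x))) ⟩
  s k (f (g (s k x)))             ≡⟨ cong (s k) (fg (s k x)) ⟩
  s k (s k x)                     ≡⟨ s-involutive k x ⟩
  x                               ∎
  where open ≡-Reasoning

conj-bounded : ∀ {n k} {f : Perm} → 1 ≤ k → k < n → (∀ x → 1 ≤ x → x ≤ n → 1 ≤ f x × f x ≤ n) →
               ∀ x → 1 ≤ x → x ≤ n → 1 ≤ conj k f x × conj k f x ≤ n
conj-bounded {k = k} {f} 1≤k k<n f-bounded x 1≤x x≤n =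
  let (1≤sx , sx≤n) = s-bounded k 1≤k k<n 1≤x x≤n
      (1≤fsx , fsx≤n) = f-bounded (s k x) 1≤sx sx≤n
  in s-bounded k 1≤k k<n 1≤fsx fsx≤n

conj-fixes-above : ∀ {n k} {f : Perm} → k < n → (∀ x → n < x → f x ≡ x) → ∀ x → n < x → conj k f x ≡ x
conj-fixes-above {k = k} {f} k<n f-fixes x n<x =
  trans (cong (s k ∘ f) sx≡x) (trans (cong (s k) (f-fixes x n<x)) sx≡x)
  where
  sx≡x : s k x ≡ x
  sx≡x = s-above k (<-≤-trans (s≤s k<n) n<x)

conj-no-fixed-point : ∀ k (f : Perm) {x} → f (s k x) ≢ s k x → conj k f x ≢ x
conj-no-fixed-point k f {x} f-moves e = f-moves (trans (sym (s-involutive k (f (s k x)))) (cong (s k) e))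

up-kept : ∀ k c d {x} → x ≢ k → x ≢ suc k → Up c d x → Up (conj k c) (conj k d) x
up-kept k c d {x} x≢k x≢k+1 (x<cx , dx<x) rewrite s-elsewhere k x≢k x≢k+1 =
  proj₁ (s-same-side k (c x) x≢k x≢k+1) x<cx , proj₂ (s-same-side k (d x) x≢k x≢k+1) dx<x

module StatusFlip {n : ℕ} {c d : Perm} (u : Unimodal n c d) {k : ℕ} (1≤k : 1 ≤ k) (k<n : k < n) where
  open Unimodal u

  c⇒d : ∀ {x y} → c x ≡ y → d y ≡ x
  c⇒d {x} cx≡y = trans (cong d (sym cx≡y)) (inverseˡ x)

  d⇒c : ∀ {x y} → d x ≡ y → c y ≡ x
  d⇒c {x} dx≡y = trans (cong c (sym dx≡y)) (inverseʳ x)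

  s-c-suc-k<k : d k < k → c (suc k) < suc k → s k (c (suc k)) < k
  s-c-suc-k<k dk<k ck+1<k+1 = subst (_< k) (sym (s-below k ck+1<k)) ck+1<k
    where
    ck+1<k : c (suc k) < k
    ck+1<k = ≤∧≢⇒< (≤-pred ck+1<k+1) (λ e → <-irrefl (c⇒d e) (<-trans dk<k (n<1+n k)))

  down-at-k : Up c d k → (suc k < n → Down c d (suc k)) → Down (conj k c) (conj k d) k
  down-at-k (k<ck , dk<k) next-down rewrite s-at-k k with m≤n⇒m<n∨m≡n k<n
  ... | inj₁ k+1<n =
    let (k+1<dk+1 , ck+1<k+1) = next-down k+1<n
    in subst (k <_) (sym (s-above k k+1<dk+1)) (<-trans (n<1+n k) k+1<dk+1) , s-c-suc-k<k dk<k ck+1<k+1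
  ... | inj₂ k+1≡n =
    subst (k <_) (sym (trans (cong (s k) dk+1≡k) (s-at-k k))) (n<1+n k) ,
    s-c-suc-k<k dk<k (subst (λ m → c m < m) (sym k+1≡n) c-n)
    where
    dk+1≡k : d (suc k) ≡ k
    dk+1≡k = c⇒d (≤-antisym (subst (c k ≤_) (sym k+1≡n) (proj₂ (c-bounded k 1≤k (<⇒≤ k<n)))) k<ck)

  down-at-suc-k : suc k < n → Up c d (suc k) → (1 < k → Down c d k) → Down (conj k c) (conj k d) (suc k)
  down-at-suc-k k+1<n (k+1<ck+1 , dk+1<k+1) previous-down rewrite s-at-suc-k k =
    subst (suc k <_) (sym (s-above k k+1<dk)) k+1<dk , s-ck<k+1
    where
    k<dk : k < d k
    k<dk with 1≤⇒≡1⊎1< 1≤k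
    ... | inj₁ k≡1 = subst (λ m → m < d m) (sym k≡1) d-1
    ... | inj₂ 1<k = proj₁ (previous-down 1<k)
    k+1<dk : suc k < d k
    k+1<dk = ≤∧≢⇒< k<dk (λ k+1≡dk → <-asym (n<1+n k) (subst (suc k <_) (d⇒c (sym k+1≡dk)) k+1<ck+1))
    s-ck<k+1 : s k (c k) < suc k
    s-ck<k+1 with 1≤⇒≡1⊎1< 1≤k
    ... | inj₁ k≡1 = subst (_< suc k) (sym (trans (cong (s k) (d⇒c dk+1≡k)) (s-at-suc-k k))) (n<1+n k)
      where
      dk+1≡k : d (suc k) ≡ k
      dk+1≡k = ≤-antisym (≤-pred dk+1<k+1)
        (subst (_≤ d (suc k)) (sym k≡1) (proj₁ (d-bounded (suc k) (s≤s z≤n) (<⇒≤ k+1<n))))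
    ... | inj₂ 1<k =
      let ck<k = proj₂ (previous-down 1<k) in subst (_< suc k) (sym (s-below k ck<k)) (m<n⇒m<1+n ck<k)

module Conjugation {n : ℕ} {c d : Perm} (u : Unimodal n c d) {k : ℕ} (1≤k : 1 ≤ k) (k<n : k < n)
                   (initial : d (suc k) < d k) where
  open Unimodal u
  open CycleOrder u using (1≤n; no-fixed-point; ascent-image-≤)
  private
    module Inverse = CycleOrder (Unimodal-sym u)
    module Flip = StatusFlip u 1≤k k<n
    module Flip⁻ = StatusFlip (Unimodal-sym u) 1≤k k<n

  c′ d′ : Perm
  c′ = conj k c
  d′ = conj k d

  -- The predecessor d (k+1) < d k < k of k+1 would be an ascent skipping the ascent k.
  ¬both-up : 1 < k → Up c d k → Up c d (suc k) → ⊥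
  ¬both-up 1<k (k<ck , dk<k) (_ , dk+1<k+1) =
    <⇒≱ (n<1+n k) (subst (_≤ k) (inverseʳ (suc k)) (ascent-image-≤ 1≤x x<n x<cx 1<k k<n k<ck x<k))
    where
    x = d (suc k)
    1≤x = proj₁ (d-bounded (suc k) (s≤s z≤n) k<n)
    x<n = <-≤-trans dk+1<k+1 k<n
    x<cx = subst (x <_) (sym (inverseʳ (suc k))) dk+1<k+1
    x<k = <-trans initial dk<k

  ¬both-down : suc k < n → Down c d k → Down c d (suc k) → ⊥
  ¬both-down k+1<n (k<dk , _) (k+1<dk+1 , _) =
    <⇒≱ (<-trans k+1<dk+1 initial) (Inverse.ascent-image-≤ 1≤k k<n k<dk (s≤s 1≤k) k+1<n k+1<dk+1 (n<1+n k))

  up-k⇒down-suc-k : 1 < k → suc k < n → Up c d k → Down c d (suc k)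
  up-k⇒down-suc-k 1<k k+1<n up =
    [ ⊥-elim ∘ ¬both-up 1<k up , id ]′ (up-or-down (suc k) (m<n⇒m<1+n 1<k) k+1<n)

  down-k⇒up-suc-k : suc k < n → Down c d k → Up c d (suc k)
  down-k⇒up-suc-k k+1<n down =
    [ id , ⊥-elim ∘ ¬both-down k+1<n down ]′ (up-or-down (suc k) (s≤s 1≤k) k+1<n)

  up-suc-k⇒down-k : 1 < k → Up c d (suc k) → Down c d k
  up-suc-k⇒down-k 1<k up = [ (λ up-k → ⊥-elim (¬both-up 1<k up-k up)) , id ]′ (up-or-down k 1<k k<n)

  down-suc-k⇒up-k : suc k < n → 1 < k → Down c d (suc k) → Up c d k
  down-suc-k⇒up-k k+1<n 1<k down =
    [ id , (λ down-k → ⊥-elim (¬both-down k+1<n down-k down)) ]′ (up-or-down k 1<k k<n)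

  flip-at-k : 1 < k → (Up c d k → Down c′ d′ k) × (Down c d k → Up c′ d′ k)
  flip-at-k 1<k =
    (λ up → Flip.down-at-k up (λ k+1<n → up-k⇒down-suc-k 1<k k+1<n up)) ,
    (λ down → Flip⁻.down-at-k down (λ k+1<n → down-k⇒up-suc-k k+1<n down))

  flip-at-suc-k : suc k < n → (Up c d (suc k) → Down c′ d′ (suc k)) × (Down c d (suc k) → Up c′ d′ (suc k))
  flip-at-suc-k k+1<n =
    (λ up → Flip.down-at-suc-k k+1<n up (λ 1<k → up-suc-k⇒down-k 1<k up)) ,
    (λ down → Flip⁻.down-at-suc-k k+1<n down (λ 1<k → down-suc-k⇒up-k k+1<n 1<k down))

  keep-elsewhere : ∀ {x} → x ≢ k → x ≢ suc k → (Up c d x → Up c′ d′ x) × (Down c d x → Down c′ d′ x)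
  keep-elsewhere x≢k x≢k+1 = up-kept k c d x≢k x≢k+1 , up-kept k d c x≢k x≢k+1

  up-or-down′ : ∀ x → 1 < x → x < n → Up c′ d′ x ⊎ Down c′ d′ x
  up-or-down′ x 1<x x<n with site k x
  ... | at-k refl     = let (to-down , to-up) = flip-at-k 1<x in
                        [ inj₂ ∘ to-down , inj₁ ∘ to-up ]′ (up-or-down x 1<x x<n)
  ... | at-suc-k refl = let (to-down , to-up) = flip-at-suc-k x<n in
                        [ inj₂ ∘ to-down , inj₁ ∘ to-up ]′ (up-or-down x 1<x x<n)
  ... | elsewhere x≢k x≢k+1 = let (keep-up , keep-down) = keep-elsewhere x≢k x≢k+1 in
                              Sum.map keep-up keep-down (up-or-down x 1<x x<n)

  endpoints-move : ∀ (f : Perm) → (∀ x → 1 ≤ x → x ≤ n → 1 ≤ f x × f x ≤ n) →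
                   (∀ x → 1 ≤ x → x ≤ n → f x ≢ x) → 1 < conj k f 1 × conj k f n < n
  endpoints-move f f-bounded f-moves =
    ≤∧≢⇒< (proj₁ (f′-bounded 1 ≤-refl 1≤n)) (f′-moves 1 ≤-refl 1≤n ∘ sym) ,
    ≤∧≢⇒< (proj₂ (f′-bounded n 1≤n ≤-refl)) (f′-moves n 1≤n ≤-refl)
    where
    f′-bounded = conj-bounded 1≤k k<n f-bounded
    f′-moves : ∀ x → 1 ≤ x → x ≤ n → conj k f x ≢ x
    f′-moves x 1≤x x≤n =
      let (1≤sx , sx≤n) = s-bounded k 1≤k k<n 1≤x x≤n in conj-no-fixed-point k f (f-moves (s k x) 1≤sx sx≤n)

  conj-unimodal : Unimodal n c′ d′
  conj-unimodal = record
    { inverseʳ = conj-inverse k c d inverseʳ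
    ; inverseˡ = conj-inverse k d c inverseˡ
    ; c-bounded = conj-bounded 1≤k k<n c-bounded
    ; d-bounded = conj-bounded 1≤k k<n d-bounded
    ; c-fixes-above = conj-fixes-above k<n c-fixes-above
    ; d-fixes-above = conj-fixes-above k<n d-fixes-above
    ; c-1 = proj₁ (endpoints-move c c-bounded no-fixed-point)
    ; d-1 = proj₁ (endpoints-move d d-bounded Inverse.no-fixed-point)
    ; c-n = proj₂ (endpoints-move c c-bounded no-fixed-point)
    ; d-n = proj₂ (endpoints-move d d-bounded Inverse.no-fixed-point)
    ; up-or-down = up-or-down′ }

  ascends-conj : ∀ x → 1 < x → x < n → ascends c′ x ≡ moves k x xor ascends c x
  ascends-conj x 1<x x<n with site k x
  ... | at-k refl =
    trans (ascends-flipped c d c′ d′ (flip-at-k 1<x) (up-or-down x 1<x x<n)) (cong (_xor ascends c x) (sym (moves-at-k x)))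
  ... | at-suc-k refl =
    trans (ascends-flipped c d c′ d′ (flip-at-suc-k x<n) (up-or-down x 1<x x<n)) (cong (_xor ascends c x) (sym (moves-at-suc-k k)))
  ... | elsewhere x≢k x≢k+1 =
    trans (ascends-kept c d c′ d′ (keep-elsewhere x≢k x≢k+1) (up-or-down x 1<x x<n))
          (cong (_xor ascends c x) (sym (moves-elsewhere k x≢k x≢k+1)))

length-filterᵇ-mono : ∀ {A : Set} (p q : A → Bool) xs → All (λ x → T (p x) → T (q x)) xs →
                      length (filterᵇ p xs) ≤ length (filterᵇ q xs)
length-filterᵇ-mono p q []       []         = z≤n
length-filterᵇ-mono p q (x ∷ xs) (p⇒q ∷ ps) with p x | q x | p⇒q
... | true  | true  | _   = s≤s (length-filterᵇ-mono p q xs ps)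
... | true  | false | p⇒q′ = ⊥-elim (p⇒q′ tt)
... | false | true  | _   = m≤n⇒m≤1+n (length-filterᵇ-mono p q xs ps)
... | false | false | _   = length-filterᵇ-mono p q xs ps

pairs-increasing : ∀ n → All (λ (a , b) → a < b) (pairs n)
pairs-increasing n =
  concat⁺ (map⁺ (applyUpTo⁺₁ suc n (λ {b} _ → map⁺ (applyUpTo⁺₁ suc b (λ a<b → s≤s a<b)))))

-- If d k < d (k+1), every inversion of c stays an inversion of s_k c.
initial⇒inverse-descent : ∀ {n c d k} → Unimodal n c d → IsInitial n k c → d (suc k) < d k
initial⇒inverse-descent {n} {c} {d} {k} u initial with d (suc k) <? d k
... | yes dk+1<dk = dk+1<dk
... | no dk+1≮dk = ⊥-elim (<⇒≱ initial
        (length-filterᵇ-mono _ _ (pairs n) (All.map inversion-kept (pairs-increasing n))))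
  where
  open Unimodal u
  dk<dk+1 : d k < d (suc k)
  dk<dk+1 = ≤∧≢⇒< (≮⇒≥ dk+1≮dk) (λ e → 1+n≢n (sym (trans (sym (inverseʳ k)) (trans (cong c e) (inverseʳ (suc k))))))
  inversion-kept : ∀ {(a , b) : ℕ × ℕ} → a < b → T (c b <ᵇ c a) → T (s k (c b) <ᵇ s k (c a))
  inversion-kept {a , b} a<b inv = <⇒<ᵇ (s-preserves-< k (<ᵇ⇒< _ _ inv) not-k+1-k)
    where
    not-k+1-k : ¬ (c a ≡ suc k × c b ≡ k)
    not-k+1-k (ca≡k+1 , cb≡k) = <-asym dk<dk+1
      (subst₂ _<_ (sym (trans (cong d (sym ca≡k+1)) (inverseˡ a))) (sym (trans (cong d (sym cb≡k)) (inverseˡ b))) a<b)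

indicator : Bool → ℕ
indicator b = if b then 1 else 0

inKK≡indicator-moves : ∀ k x → inKK k x ≡ indicator (moves k x)
inKK≡indicator-moves k x with x ≡ᵇ k
... | true  = refl
... | false = refl

indicator-+-parity : ∀ a b → (indicator a + indicator b) % 2 ≡ indicator (a xor b)
indicator-+-parity true  true  = refl
indicator-+-parity true  false = refl
indicator-+-parity false true  = refl
indicator-+-parity false false = refl

interCount-parity : ∀ k i j → interCount k i j % 2 ≡ indicator (moves k i xor moves k j)
interCount-parity k i j = begin
  (inKK k i + inKK k j) % 2                                ≡⟨ cong (_% 2) (cong₂ _+_ (inKK≡indicator-moves k i) (inKK≡indicator-moves k j)) ⟩
  (indicator (moves k i) + indicator (moves k j)) % 2      ≡⟨ indicator-+-parity (moves k i) (moves k j) ⟩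
  indicator (moves k i xor moves k j)                      ∎
  where open ≡-Reasoning

parity-transfer : ∀ {A B : Set} a f {m} → A ⇔ T a → B ⇔ T (f xor a) → m ≡ indicator f →
                  A ⇔ ((B × m ≡ 0) ⊎ (¬ B × m ≡ 1))
parity-transfer true  false A⇔ B⇔ refl = mk⇔ (λ _ → inj₁ (from B⇔ tt , refl)) (λ _ → from A⇔ tt)
parity-transfer true  true  A⇔ B⇔ refl = mk⇔ (λ _ → inj₂ (to B⇔ , refl)) (λ _ → from A⇔ tt)
parity-transfer false false A⇔ B⇔ refl =
  mk⇔ (⊥-elim ∘ to A⇔) [ ⊥-elim ∘ to B⇔ ∘ proj₁ , (λ ()) ∘ proj₂ ]′
parity-transfer false true  A⇔ B⇔ refl =
  mk⇔ (⊥-elim ∘ to A⇔) [ (λ ()) ∘ proj₂ , (λ (¬b , _) → ⊥-elim (¬b (from B⇔ tt))) ]′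

proposition2p7 : (n : ℕ) (c : Perm) → IsStdCoxeter n c →
    (k : ℕ) → 1 ≤ k → k < n → IsInitial n k c →
    (i j : ℕ) → 1 < i → i < j → j < n →
    Charmed n c i j ⇔
      ((Charmed n (s k ∘ₚ (c ∘ₚ s k)) i j × interCount k i j % 2 ≡ 0)
       ⊎ (Ordinary n (s k ∘ₚ (c ∘ₚ s k)) i j × interCount k i j % 2 ≡ 1))
proposition2p7 n c std k 1≤k k<n initial i j 1<i i<j j<n =
  parity-transfer (ascends c i xor ascends c j) (moves k i xor moves k j)
    (Before.Charmed⇔ascents-differ 1<i i<n 1<j j<n)
    (subst (λ b → Charmed n c′ i j ⇔ T b) ascents-differ-conj
      (After.Charmed⇔ascents-differ 1<i i<n 1<j j<n))
    (interCount-parity k i j)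
  where
  i<n = <-trans i<j j<n
  1<j = <-trans 1<i i<j
  u = proj₂ (stdCoxeter-unimodal (≤-<-trans 1≤k k<n) std)
  open Conjugation u 1≤k k<n (initial⇒inverse-descent u initial) using (c′; conj-unimodal; ascends-conj)
  module Before = CycleOrder u
  module After = CycleOrder conj-unimodal
  ascents-differ-conj : ascends c′ i xor ascends c′ j ≡ (moves k i xor moves k j) xor (ascends c i xor ascends c j)
  ascents-differ-conj = trans (cong₂ _xor_ (ascends-conj i 1<i i<n) (ascends-conj j 1<j j<n))
                              (interchange (moves k i) (ascends c i) (moves k j) (ascends c j))
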